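{- Let $\mathbb{C}$ be one of $\mathbb{C}_{\mathrm{rn}},\mathbb{C}_{\mathrm{vs}},\mathbb{C}_{\mathrm{ts}}$, let $T$ be a coherent theory and $\Vdash$ the forcing relation on $\mathbb{C}$ with respect to $\lhd_T$. Then for every generalized geometric sentence $\phi$: if $(;)\Vdash\phi$, then $T\vdash_\emptyset\phi$.
   Context: Fix a single-sorted signature $\Sigma$ without equality and countably many variables; $\mathrm{Tm}(X)$ = terms over $X$. Conditions $(X;A)$: $X$ finite set of variables, $A$ finite set of atoms over $X$; $(;)$ is the condition with no variables and no atoms (a terminal object). $\mathbb{C}_{\mathrm{ts}}$: morphisms $f:(Y;B)\to(X;A)$ are maps $f:X\to\mathrm{Tm}(Y)$ with $Af\subseteq B$ (substitution postfix); $\mathbb{C}_{\mathrm{vs}}$: variable-to-variable maps; $\mathbb{C}_{\mathrm{rn}}$: injective variable maps. Coherent theory: axioms $\forall\vec x.(\phi_0\to\exists\vec x_1.\phi_1\lor\dots\lor\exists\vec x_k.\phi_k)$, $\phi_i$ finite conjunctions of atoms. $C\lhd_T U$ is inductively generated by: isomorphism singletons cover; and if an instance (terms of $\mathrm{Tm}(X)$ for universal variables) $\phi_0\to\exists\vec x_1.\phi_1\lor\dots\lor\exists\vec x_n.\phi_n$ of an axiom has $\phi_0\subseteq A$, with $\vec x_i$ fresh and $(X,\vec x_i;A,\phi_i)\lhd_T U_i$, then $(X;A)\lhd_T\bigcup_ie_iU_i$, $e_i$ the identity-on-$X$ morphism $(X,\vec x_i;A,\phi_i)\to(X;A)$. Forcing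 $\Vdash$ is the Kripke–Joyal-style relation: $\top$ always; $\bot$ iff $C\lhd_T\emptyset$; atom $\psi$ iff some cover $U\rhd C$ with $\psi f$ among the atoms of the domain for each $f\in U$; $\bigwedge$ componentwise; $\bigvee_i\psi_i$ iff some cover on each member $f:D\to C$ of which $D\Vdash\psi_if$ for some $i$; $\psi_1\to\psi_2$ iff for all $f:D\to C$, $D\Vdash\psi_1f\Rightarrow D\Vdash\psi_2f$; $\forall x.\psi$ iff $D\Vdash\psi[f,x:=t]$ for all $f:D\to C$, $t\in\mathrm{Tm}(D)$; $\exists x.\psi$ iff some cover on each member $f:D\to C$ of which $D\Vdash\psi[f,x:=t]$ for some $t\in\mathrm{Tm}(D)$. Generalized geometric implications: $\phi::=\alpha\mid\phi_1\land\phi_2\mid\bigvee_{i\in I}\phi_i\mid\exists x.\phi\mid\forall x.\phi\mid\alpha\to\phi$ with $\alpha$ an atom, $\top$ or $\bot$. $T\vdash_\emptyset\phi$: derivability in intuitionistic (possibly infinitary) natural deduction with empty variable context, using quantifier rules valid for possibly empty domains (existential introduction and universal elimination only with terms over the current variable context). -}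

module Defs where

open import Data.Nat using (ℕ; zero; suc; _+_)
open import Data.Fin using (Fin; zero; suc; _↑ʳ_; _↑ˡ_; splitAt)
open import Data.Vec using (Vec; []; _∷_)
open import Data.List using (List; []; _∷_; map; _++_; foldr)
open import Data.List.Membership.Propositional using (_∈_)
open import Data.Product using (Σ; _×_; _,_)
open import Data.Sum using (_⊎_; inj₁; inj₂; [_,_])
open import Data.Unit using (⊤)
open import Data.Empty using (⊥)
open import Relation.Binary.PropositionalEquality using (_≡_)

-- Single-sorted first-order signature without equality.

record Signature : Set₁ where
  field
    Fun   : Set
    Rel   : Set
    funAr : Fun → ℕ
    relAr : Rel → ℕ

data Kind : Set where
  rn vs ts : Kind

module _ (S : Signature) where
  open Signature S

  data Tm (n : ℕ) : Set where
    var : Fin n → Tm n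
    fn  : (f : Fun) → Vec (Tm n) (funAr f) → Tm n

  data Atom (n : ℕ) : Set where
    rel : (R : Rel) → Vec (Tm n) (relAr R) → Atom n

  Subst : ℕ → ℕ → Set
  Subst n m = Fin n → Tm m

  mutual
    _⟨_⟩ : ∀ {n m} → Tm n → Subst n m → Tm m
    var x    ⟨ σ ⟩ = σ x
    fn f us  ⟨ σ ⟩ = fn f (substs us σ)

    substs : ∀ {n m k} → Vec (Tm n) k → Subst n m → Vec (Tm m) k
    substs []       σ = []
    substs (t ∷ us) σ = (t ⟨ σ ⟩) ∷ substs us σ

  _⟨_⟩ₐ : ∀ {n m} → Atom n → Subst n m → Atom m
  rel R us ⟨ σ ⟩ₐ = rel R (substs us σ)

  -- composition of substitutions: first σ then τ
  _⨾_ : ∀ {n m k} → Subst n m → Subst m k → Subst n k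
  (σ ⨾ τ) x = σ x ⟨ τ ⟩

  _∷ₛ_ : ∀ {n m} → Tm m → Subst n m → Subst (suc n) m
  (t ∷ₛ σ) zero    = t
  (t ∷ₛ σ) (suc x) = σ x

  wkSub : ∀ {n} k → Subst n (k + n)
  wkSub k x = var (k ↑ʳ x)

  ⇑ : ∀ {n m} → Subst n m → Subst (suc n) (suc m)
  ⇑ σ zero    = var zero
  ⇑ σ (suc x) = σ x ⟨ (λ y → var (suc y)) ⟩

  -- Conditions (X;A): nv variables, a finite set (list) A of atoms over them.

  record Cond : Set where
    constructor cond
    field
      nv    : ℕ
      atoms : List (Atom nv)
  open Cond public

  empty : Cond
  empty = cond 0 []

  -- admissibility of a substitution as a morphism of the chosen category
  Adm : Kind → ∀ {n m} → Subst n m → Set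
  Adm ts σ = ⊤
  Adm vs σ = ∀ x → Σ _ λ y → σ x ≡ var y
  Adm rn σ = (∀ x → Σ _ λ y → σ x ≡ var y) × (∀ x y → σ x ≡ σ y → x ≡ y)

  -- morphisms f : D → C are maps X_C → Tm(X_D) with A_C f ⊆ A_D
  record Hom (κ : Kind) (D C : Cond) : Set where
    field
      sub  : Subst (nv C) (nv D)
      pres : ∀ {a} → a ∈ atoms C → (a ⟨ sub ⟩ₐ) ∈ atoms D
      adm  : Adm κ sub
  open Hom public

  IsIso : ∀ {κ D C} → Hom κ D C → Set
  IsIso {κ} {D} {C} g =
    Σ (Hom κ C D) λ h →
      (∀ x → (sub g ⨾ sub h) x ≡ var x) × (∀ y → (sub h ⨾ sub g) y ≡ var y)

  -- Coherent axioms  ∀x⃗.(φ₀ → ∃x⃗₁.φ₁ ∨ … ∨ ∃x⃗ₖ.φₖ)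
  -- universal variables: Fin univ; in disjunct i the variables are
  -- Fin (exv i + univ): the first exv i are the existential ones.

  record Axiom : Set where
    field
      univ  : ℕ
      prem  : List (Atom univ)
      ndisj : ℕ
      exv   : Fin ndisj → ℕ
      concl : (i : Fin ndisj) → List (Atom (exv i + univ))
  open Axiom public

  record Theory : Set₁ where
    field
      Ax    : Set
      axiom : Ax → Axiom
  open Theory public

  -- instance substitution for disjunct i, into the extended condition
  instSub : ∀ {u n} k → Subst u n → Subst (k + u) (k + n)
  instSub {u} {n} k σ x = [ (λ j → var (j ↑ˡ n)) , (λ y → σ y ⟨ wkSub k ⟩) ] (splitAt k x)

  -- (X, x⃗ᵢ ; A, φᵢ) with fresh variables x⃗ᵢ
  extCond : (C : Cond) (a : Axiom) → Subst (univ a) (nv C) → Fin (ndisj a) → Cond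
  extCond C a σ i =
    cond (exv a i + nv C)
         (map (λ α → α ⟨ wkSub (exv a i) ⟩ₐ) (atoms C)
           ++ map (λ α → α ⟨ instSub (exv a i) σ ⟩ₐ) (concl a i))

  -- Covers C ◁_T U, inductively generated.  A cover is given by its
  -- generating derivation; its set of members is the relation Mem.

  module Covers (κ : Kind) (T : Theory) where

    data Cover (C : Cond) : Set where
      isoCov : ∀ {D} (g : Hom κ D C) → IsIso g → Cover C
      axCov  : (ax : Ax T) (σ : Subst (univ (axiom T ax)) (nv C))
               → (∀ α → α ∈ prem (axiom T ax) → (α ⟨ σ ⟩ₐ) ∈ atoms C)
               → ((i : Fin (ndisj (axiom T ax))) → Cover (extCond C (axiom T ax) σ i))
               → Cover C

    -- membership of a morphism in the cover (equality of morphisms is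
    -- equality of the underlying maps)
    data Mem : ∀ {C D} → Cover C → Hom κ D C → Set where
      memIso : ∀ {C D} {g : Hom κ D C} {iso : IsIso g} {f : Hom κ D C}
               → (∀ x → sub f x ≡ sub g x) → Mem (isoCov g iso) f
      memAx  : ∀ {C D} {ax σ p U} (i : Fin (ndisj (axiom T ax)))
               {h : Hom κ D (extCond C (axiom T ax) σ i)} {f : Hom κ D C}
               → Mem (U i) h
               → (∀ x → sub f x ≡ sub h (exv (axiom T ax) i ↑ʳ x))
               → Mem (axCov ax σ p U) f

  data Base (n : ℕ) : Set where
    atomB : Atom n → Base n
    ⊤B ⊥B : Base n

  data GG (n : ℕ) : Set₁ where
    base : Base n → GG n
    _∧G_ : GG n → GG n → GG n
    ⋁G   : (I : Set) → (I → GG n) → GG n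
    ∃G   : GG (suc n) → GG n
    ∀G   : GG (suc n) → GG n
    _⇒G_ : Base n → GG n → GG n

  -- Forcing.  Force C φ ρ  means  C ⊩ φρ  (φ with its free variables
  -- instantiated by ρ into Tm(C)).

  module Forcing (κ : Kind) (T : Theory) where
    open Covers κ T

    ForceB : (C : Cond) → ∀ {n} → Base n → Subst n (nv C) → Set
    ForceB C (atomB α) ρ =
      Σ (Cover C) λ U → ∀ {D} (f : Hom κ D C) → Mem U f → ((α ⟨ ρ ⟩ₐ) ⟨ sub f ⟩ₐ) ∈ atoms D
    ForceB C ⊤B ρ = ⊤
    ForceB C ⊥B ρ = Σ (Cover C) λ U → ∀ {D} (f : Hom κ D C) → Mem U f → ⊥

    Force : (C : Cond) → ∀ {n} → GG n → Subst n (nv C) → Set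
    Force C (base b) ρ = ForceB C b ρ
    Force C (φ ∧G ψ) ρ = Force C φ ρ × Force C ψ ρ
    Force C (⋁G I φ) ρ =
      Σ (Cover C) λ U → ∀ {D} (f : Hom κ D C) → Mem U f →
        Σ I λ i → Force D (φ i) (ρ ⨾ sub f)
    Force C (∃G φ) ρ =
      Σ (Cover C) λ U → ∀ {D} (f : Hom κ D C) → Mem U f →
        Σ (Tm (nv D)) λ t → Force D φ (t ∷ₛ (ρ ⨾ sub f))
    Force C (∀G φ) ρ =
      ∀ D (f : Hom κ D C) (t : Tm (nv D)) → Force D φ (t ∷ₛ (ρ ⨾ sub f))
    Force C (b ⇒G φ) ρ =
      ∀ D (f : Hom κ D C) → ForceB D b (ρ ⨾ sub f) → Force D φ (ρ ⨾ sub f)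

    _⊩_ : (C : Cond) → GG (nv C) → Set
    C ⊩ φ = Force C φ var

  -- Full (infinitary) first-order formulas and intuitionistic natural
  -- deduction with quantifier rules valid for possibly empty domains.

  data Form (n : ℕ) : Set₁ where
    atomF : Atom n → Form n
    ⊤F ⊥F : Form n
    _∧F_  : Form n → Form n → Form n
    ⋁F    : (I : Set) → (I → Form n) → Form n
    _⇒F_  : Form n → Form n → Form n
    ∀F ∃F : Form (suc n) → Form n

  _⟨_⟩F : ∀ {n m} → Form n → Subst n m → Form m
  atomF α ⟨ σ ⟩F = atomF (α ⟨ σ ⟩ₐ)
  ⊤F ⟨ σ ⟩F = ⊤F
  ⊥F ⟨ σ ⟩F = ⊥F
  (φ ∧F ψ) ⟨ σ ⟩F = (φ ⟨ σ ⟩F) ∧F (ψ ⟨ σ ⟩F)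
  ⋁F I φ ⟨ σ ⟩F = ⋁F I (λ i → φ i ⟨ σ ⟩F)
  (φ ⇒F ψ) ⟨ σ ⟩F = (φ ⟨ σ ⟩F) ⇒F (ψ ⟨ σ ⟩F)
  ∀F φ ⟨ σ ⟩F = ∀F (φ ⟨ ⇑ σ ⟩F)
  ∃F φ ⟨ σ ⟩F = ∃F (φ ⟨ ⇑ σ ⟩F)

  wkF : ∀ {n} → Form n → Form (suc n)
  wkF φ = φ ⟨ (λ x → var (suc x)) ⟩F

  _[_]F : ∀ {n} → Form (suc n) → Tm n → Form n
  φ [ t ]F = φ ⟨ t ∷ₛ var ⟩F

  baseF : ∀ {n} → Base n → Form n
  baseF (atomB α) = atomF α
  baseF ⊤B = ⊤F
  baseF ⊥B = ⊥F

  embGG : ∀ {n} → GG n → Form n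
  embGG (base b) = baseF b
  embGG (φ ∧G ψ) = embGG φ ∧F embGG ψ
  embGG (⋁G I φ) = ⋁F I (λ i → embGG (φ i))
  embGG (∃G φ) = ∃F (embGG φ)
  embGG (∀G φ) = ∀F (embGG φ)
  embGG (b ⇒G φ) = baseF b ⇒F embGG φ

  conjF : ∀ {n} → List (Atom n) → Form n
  conjF = foldr (λ α φ → atomF α ∧F φ) ⊤F

  ∃* : ∀ {u} k → Form (k + u) → Form u
  ∃* zero φ = φ
  ∃* (suc k) φ = ∃* k (∃F φ)

  ∀c : ∀ u → Form u → Form 0
  ∀c zero φ = φ
  ∀c (suc u) φ = ∀c u (∀F φ)

  axForm : Axiom → Form 0
  axForm a = ∀c (univ a)
    (conjF (prem a) ⇒F ⋁F (Fin (ndisj a)) (λ i → ∃* (exv a i) (conjF (concl a i))))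

  closedWk : ∀ {n} → Form 0 → Form n
  closedWk φ = φ ⟨ (λ ()) ⟩F

  module Deduction (T : Theory) where

    infix 3 _⊢_
    data _⊢_ {n : ℕ} (Γ : List (Form n)) : Form n → Set₁ where
      hyp  : ∀ {φ} → φ ∈ Γ → Γ ⊢ φ
      ax   : (a : Ax T) → Γ ⊢ closedWk (axForm (axiom T a))
      ⊤I   : Γ ⊢ ⊤F
      ⊥E   : ∀ {φ} → Γ ⊢ ⊥F → Γ ⊢ φ
      ∧I   : ∀ {φ ψ} → Γ ⊢ φ → Γ ⊢ ψ → Γ ⊢ φ ∧F ψ
      ∧E₁  : ∀ {φ ψ} → Γ ⊢ φ ∧F ψ → Γ ⊢ φ
      ∧E₂  : ∀ {φ ψ} → Γ ⊢ φ ∧F ψ → Γ ⊢ ψ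
      ⋁I   : ∀ {I φ} (i : I) → Γ ⊢ φ i → Γ ⊢ ⋁F I φ
      ⋁E   : ∀ {I φ ψ} → Γ ⊢ ⋁F I φ → ((i : I) → (φ i ∷ Γ) ⊢ ψ) → Γ ⊢ ψ
      ⇒I   : ∀ {φ ψ} → (φ ∷ Γ) ⊢ ψ → Γ ⊢ φ ⇒F ψ
      ⇒E   : ∀ {φ ψ} → Γ ⊢ φ ⇒F ψ → Γ ⊢ φ → Γ ⊢ ψ
      ∀I   : ∀ {φ} → map wkF Γ ⊢ φ → Γ ⊢ ∀F φ
      ∀E   : ∀ {φ} → Γ ⊢ ∀F φ → (t : Tm n) → Γ ⊢ φ [ t ]F
      ∃I   : ∀ {φ} (t : Tm n) → Γ ⊢ φ [ t ]F → Γ ⊢ ∃F φ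
      ∃E   : ∀ {φ ψ} → Γ ⊢ ∃F φ → (φ ∷ map wkF Γ) ⊢ wkF ψ → Γ ⊢ ψ

    ⊢∅ : Form 0 → Set₁
    ⊢∅ φ = [] ⊢ φ

module Submission where

-- We prove the stronger statement that C ⊩ φρ implies that φρ is derivable
-- from the atoms of the condition C (regarded as hypotheses), by induction
-- on φ.  The terminal condition (;) has no atoms, which gives the corollary.

open import Defs
open import Data.Nat using (zero; suc; _+_)
open import Data.Fin using (Fin; zero; suc; _↑ʳ_; splitAt)
open import Data.Fin.Properties using (suc-injective; ↑ʳ-injective)
open import Data.Vec using (Vec; []; _∷_)
open import Data.List using (List; []; _∷_; map)
open import Data.List.Properties using (map-∘)
open import Data.List.Membership.Propositional using (_∈_)
open import Data.List.Membership.Propositional.Properties using (∈-map⁺; ∈-map⁻; ∈-++⁺ˡ; ∈-++⁻)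
open import Data.List.Relation.Unary.Any using (here; there)
open import Data.Product using (Σ; _×_; _,_)
open import Data.Sum using (inj₁; inj₂)
open import Data.Unit using (tt)
open import Data.Empty using (⊥-elim)
open import Function using (_∘_)
open import Relation.Binary.PropositionalEquality using (_≡_; refl; sym; trans; cong; cong₂; subst)

module Substitution (S : Signature) where

  infixl 8 _⟦_⟧ _⟦_⟧ₐ _⟦_⟧F
  infixl 7 _⨟_
  infixr 5 _∷s_
  infix  4 _≈_ _≅_

  _⟦_⟧ : ∀ {n m} → Tm S n → Subst S n m → Tm S m
  t ⟦ σ ⟧ = _⟨_⟩ S t σ

  _⟦_⟧ₐ : ∀ {n m} → Atom S n → Subst S n m → Atom S m
  α ⟦ σ ⟧ₐ = _⟨_⟩ₐ S α σ

  _⟦_⟧F : ∀ {n m} → Form S n → Subst S n m → Form S m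
  A ⟦ σ ⟧F = _⟨_⟩F S A σ

  _⨟_ : ∀ {n m k} → Subst S n m → Subst S m k → Subst S n k
  σ ⨟ τ = _⨾_ S σ τ

  _∷s_ : ∀ {n m} → Tm S m → Subst S n m → Subst S (suc n) m
  t ∷s σ = _∷ₛ_ S t σ

  ⇧ : ∀ {n m} → Subst S n m → Subst S (suc n) (suc m)
  ⇧ = ⇑ S

  wk1 : ∀ {n} → Subst S n (suc n)
  wk1 x = var (suc x)

  _≈_ : ∀ {n m} → Subst S n m → Subst S n m → Set
  σ ≈ τ = ∀ x → σ x ≡ τ x

  mutual
    tm-ext : ∀ {n m} {σ τ : Subst S n m} → σ ≈ τ → (t : Tm S n) → t ⟦ σ ⟧ ≡ t ⟦ τ ⟧
    tm-ext e (var x)   = e x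
    tm-ext e (fn f us) = cong (fn f) (tms-ext e us)

    tms-ext : ∀ {n m k} {σ τ : Subst S n m} → σ ≈ τ → (us : Vec (Tm S n) k) →
      substs S us σ ≡ substs S us τ
    tms-ext e []       = refl
    tms-ext e (t ∷ us) = cong₂ _∷_ (tm-ext e t) (tms-ext e us)

  mutual
    tm-comp : ∀ {n m k} (σ : Subst S n m) (τ : Subst S m k) (t : Tm S n) →
      t ⟦ σ ⟧ ⟦ τ ⟧ ≡ t ⟦ σ ⨟ τ ⟧
    tm-comp σ τ (var x)   = refl
    tm-comp σ τ (fn f us) = cong (fn f) (tms-comp σ τ us)

    tms-comp : ∀ {n m k j} (σ : Subst S n m) (τ : Subst S m k) (us : Vec (Tm S n) j) →
      substs S (substs S us σ) τ ≡ substs S us (σ ⨟ τ)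
    tms-comp σ τ []       = refl
    tms-comp σ τ (t ∷ us) = cong₂ _∷_ (tm-comp σ τ t) (tms-comp σ τ us)

  mutual
    tm-id : ∀ {n} (t : Tm S n) → t ⟦ var ⟧ ≡ t
    tm-id (var x)   = refl
    tm-id (fn f us) = cong (fn f) (tms-id us)

    tms-id : ∀ {n k} (us : Vec (Tm S n) k) → substs S us var ≡ us
    tms-id []       = refl
    tms-id (t ∷ us) = cong₂ _∷_ (tm-id t) (tms-id us)

  at-ext : ∀ {n m} {σ τ : Subst S n m} → σ ≈ τ → (α : Atom S n) → α ⟦ σ ⟧ₐ ≡ α ⟦ τ ⟧ₐ
  at-ext e (rel R us) = cong (rel R) (tms-ext e us)

  at-comp : ∀ {n m k} (σ : Subst S n m) (τ : Subst S m k) (α : Atom S n) →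
    α ⟦ σ ⟧ₐ ⟦ τ ⟧ₐ ≡ α ⟦ σ ⨟ τ ⟧ₐ
  at-comp σ τ (rel R us) = cong (rel R) (tms-comp σ τ us)

  at-id : ∀ {n} (α : Atom S n) → α ⟦ var ⟧ₐ ≡ α
  at-id (rel R us) = cong (rel R) (tms-id us)

  ⨟-var : ∀ {n m} {σ : Subst S n m} {τ : Subst S m m} → τ ≈ var → σ ⨟ τ ≈ σ
  ⨟-var {σ = σ} e x = trans (tm-ext e (σ x)) (tm-id (σ x))

  ⨟-idʳ : ∀ {n m} {σ : Subst S n m} → σ ⨟ var ≈ σ
  ⨟-idʳ = ⨟-var (λ _ → refl)

  ⨟-assoc : ∀ {n m k j} (σ : Subst S n m) (τ : Subst S m k) (υ : Subst S k j) →
    (σ ⨟ τ) ⨟ υ ≈ σ ⨟ (τ ⨟ υ)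
  ⨟-assoc σ τ υ x = tm-comp τ υ (σ x)

  ⇧-ext : ∀ {n m} {σ τ : Subst S n m} → σ ≈ τ → ⇧ σ ≈ ⇧ τ
  ⇧-ext e zero    = refl
  ⇧-ext e (suc x) = cong (_⟦ wk1 ⟧) (e x)

  ⇧-comp : ∀ {n m k} (σ : Subst S n m) (τ : Subst S m k) → ⇧ σ ⨟ ⇧ τ ≈ ⇧ (σ ⨟ τ)
  ⇧-comp σ τ zero    = refl
  ⇧-comp σ τ (suc x) = trans (tm-comp wk1 (⇧ τ) (σ x)) (sym (tm-comp τ wk1 (σ x)))

  ⇧-id : ∀ {n} → ⇧ (var {S = S} {n = n}) ≈ var
  ⇧-id zero    = refl
  ⇧-id (suc x) = refl

  ⇧-inst : ∀ {n m} (σ : Subst S n m) (t : Tm S m) → ⇧ σ ⨟ (t ∷s var) ≈ t ∷s σ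
  ⇧-inst σ t zero    = refl
  ⇧-inst σ t (suc x) = trans (tm-comp wk1 (t ∷s var) (σ x)) (tm-id (σ x))

  data _≅_ : ∀ {n} → Form S n → Form S n → Set₁ where
    atom≅ : ∀ {n} {α β : Atom S n} → α ≡ β → atomF α ≅ atomF β
    ⊤≅    : ∀ {n} → ⊤F {S = S} {n = n} ≅ ⊤F
    ⊥≅    : ∀ {n} → ⊥F {S = S} {n = n} ≅ ⊥F
    _∧≅_  : ∀ {n} {A A′ B B′ : Form S n} → A ≅ A′ → B ≅ B′ → A ∧F B ≅ A′ ∧F B′
    ⋁≅    : ∀ {n I} {φ ψ : I → Form S n} → (∀ i → φ i ≅ ψ i) → ⋁F I φ ≅ ⋁F I ψ
    _⇒≅_  : ∀ {n} {A A′ B B′ : Form S n} → A ≅ A′ → B ≅ B′ → A ⇒F B ≅ A′ ⇒F B′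
    ∀≅    : ∀ {n} {A A′ : Form S (suc n)} → A ≅ A′ → ∀F A ≅ ∀F A′
    ∃≅    : ∀ {n} {A A′ : Form S (suc n)} → A ≅ A′ → ∃F A ≅ ∃F A′

  ≅-refl : ∀ {n} (A : Form S n) → A ≅ A
  ≅-refl (atomF α) = atom≅ refl
  ≅-refl ⊤F        = ⊤≅
  ≅-refl ⊥F        = ⊥≅
  ≅-refl (A ∧F B)  = ≅-refl A ∧≅ ≅-refl B
  ≅-refl (⋁F I φ)  = ⋁≅ (λ i → ≅-refl (φ i))
  ≅-refl (A ⇒F B)  = ≅-refl A ⇒≅ ≅-refl B
  ≅-refl (∀F A)    = ∀≅ (≅-refl A)
  ≅-refl (∃F A)    = ∃≅ (≅-refl A)

  ≅-sym : ∀ {n} {A B : Form S n} → A ≅ B → B ≅ A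
  ≅-sym (atom≅ e) = atom≅ (sym e)
  ≅-sym ⊤≅        = ⊤≅
  ≅-sym ⊥≅        = ⊥≅
  ≅-sym (p ∧≅ q)  = ≅-sym p ∧≅ ≅-sym q
  ≅-sym (⋁≅ p)    = ⋁≅ (λ i → ≅-sym (p i))
  ≅-sym (p ⇒≅ q)  = ≅-sym p ⇒≅ ≅-sym q
  ≅-sym (∀≅ p)    = ∀≅ (≅-sym p)
  ≅-sym (∃≅ p)    = ∃≅ (≅-sym p)

  ≅-trans : ∀ {n} {A B C : Form S n} → A ≅ B → B ≅ C → A ≅ C
  ≅-trans (atom≅ e) (atom≅ e′) = atom≅ (trans e e′)
  ≅-trans ⊤≅        ⊤≅         = ⊤≅
  ≅-trans ⊥≅        ⊥≅         = ⊥≅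
  ≅-trans (p ∧≅ q)  (p′ ∧≅ q′) = ≅-trans p p′ ∧≅ ≅-trans q q′
  ≅-trans (⋁≅ p)    (⋁≅ p′)    = ⋁≅ (λ i → ≅-trans (p i) (p′ i))
  ≅-trans (p ⇒≅ q)  (p′ ⇒≅ q′) = ≅-trans p p′ ⇒≅ ≅-trans q q′
  ≅-trans (∀≅ p)    (∀≅ p′)    = ∀≅ (≅-trans p p′)
  ≅-trans (∃≅ p)    (∃≅ p′)    = ∃≅ (≅-trans p p′)

  F-ext : ∀ {n m} {σ τ : Subst S n m} → σ ≈ τ → (A : Form S n) → A ⟦ σ ⟧F ≅ A ⟦ τ ⟧F
  F-ext e (atomF α) = atom≅ (at-ext e α)
  F-ext e ⊤F        = ⊤≅
  F-ext e ⊥F        = ⊥≅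
  F-ext e (A ∧F B)  = F-ext e A ∧≅ F-ext e B
  F-ext e (⋁F I φ)  = ⋁≅ (λ i → F-ext e (φ i))
  F-ext e (A ⇒F B)  = F-ext e A ⇒≅ F-ext e B
  F-ext e (∀F A)    = ∀≅ (F-ext (⇧-ext e) A)
  F-ext e (∃F A)    = ∃≅ (F-ext (⇧-ext e) A)

  F-comp : ∀ {n m k} {σ : Subst S n m} {τ : Subst S m k} (A : Form S n) →
    A ⟦ σ ⟧F ⟦ τ ⟧F ≅ A ⟦ σ ⨟ τ ⟧F
  F-comp {σ = σ} (atomF α) = atom≅ (at-comp σ _ α)
  F-comp ⊤F       = ⊤≅
  F-comp ⊥F       = ⊥≅
  F-comp (A ∧F B) = F-comp A ∧≅ F-comp B
  F-comp (⋁F I φ) = ⋁≅ (λ i → F-comp (φ i))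
  F-comp (A ⇒F B) = F-comp A ⇒≅ F-comp B
  F-comp {σ = σ} {τ} (∀F A) = ∀≅ (≅-trans (F-comp A) (F-ext (⇧-comp σ τ) A))
  F-comp {σ = σ} {τ} (∃F A) = ∃≅ (≅-trans (F-comp A) (F-ext (⇧-comp σ τ) A))

  F-fuse : ∀ {n m k} {σ : Subst S n m} {τ : Subst S m k} {υ : Subst S n k} →
    σ ⨟ τ ≈ υ → (A : Form S n) → A ⟦ σ ⟧F ⟦ τ ⟧F ≅ A ⟦ υ ⟧F
  F-fuse e A = ≅-trans (F-comp A) (F-ext e A)

  F-id : ∀ {n} (A : Form S n) → A ⟦ var ⟧F ≅ A
  F-id (atomF α) = atom≅ (at-id α)
  F-id ⊤F        = ⊤≅
  F-id ⊥F        = ⊥≅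
  F-id (A ∧F B)  = F-id A ∧≅ F-id B
  F-id (⋁F I φ)  = ⋁≅ (λ i → F-id (φ i))
  F-id (A ⇒F B)  = F-id A ⇒≅ F-id B
  F-id (∀F A)    = ∀≅ (≅-trans (F-ext ⇧-id A) (F-id A))
  F-id (∃F A)    = ∃≅ (≅-trans (F-ext ⇧-id A) (F-id A))

  F-cong : ∀ {n m} {A B : Form S n} (σ : Subst S n m) → A ≅ B → A ⟦ σ ⟧F ≅ B ⟦ σ ⟧F
  F-cong σ (atom≅ e) = atom≅ (cong (_⟦ σ ⟧ₐ) e)
  F-cong σ ⊤≅        = ⊤≅
  F-cong σ ⊥≅        = ⊥≅
  F-cong σ (p ∧≅ q)  = F-cong σ p ∧≅ F-cong σ q
  F-cong σ (⋁≅ p)    = ⋁≅ (λ i → F-cong σ (p i))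
  F-cong σ (p ⇒≅ q)  = F-cong σ p ⇒≅ F-cong σ q
  F-cong σ (∀≅ p)    = ∀≅ (F-cong (⇧ σ) p)
  F-cong σ (∃≅ p)    = ∃≅ (F-cong (⇧ σ) p)

  -- weakening and then instantiating the new variable by the old bound
  -- one is the identity; this is how ∀E and ∃I recover a bound formula
  F-unshift : ∀ {n} (A : Form S (suc n)) → A ⟦ ⇧ wk1 ⟧F ⟦ var zero ∷s var ⟧F ≅ A
  F-unshift A = ≅-trans (F-fuse (λ { zero → refl ; (suc x) → refl }) A) (F-id A)

  F-inst : ∀ {n m} (A : Form S (suc n)) (σ : Subst S n m) (t : Tm S n) →
    A ⟦ ⇧ σ ⟧F ⟦ t ⟦ σ ⟧ ∷s var ⟧F ≅ A ⟦ t ∷s var ⟧F ⟦ σ ⟧F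
  F-inst A σ t = ≅-trans (F-fuse (⇧-inst σ (t ⟦ σ ⟧)) A)
                         (≅-sym (F-fuse (λ { zero → refl ; (suc x) → refl }) A))

  F-wk : ∀ {n m} (A : Form S n) (σ : Subst S n m) → A ⟦ wk1 ⟧F ⟦ ⇧ σ ⟧F ≅ A ⟦ σ ⟧F ⟦ wk1 ⟧F
  F-wk A σ = ≅-trans (F-fuse (λ _ → refl) A) (≅-sym (F-comp A))

module Derivations (S : Signature) (T : Theory S) where
  open Substitution S
  open Deduction S T

  cut : ∀ {n} {Γ : List (Form S n)} {A B} → Γ ⊢ A → (A ∷ Γ) ⊢ B → Γ ⊢ B
  cut d e = ⇒E (⇒I e) d

  -- Equivalent formulas are interderivable.  The induction is on the target
  -- formula; both directions are needed at once because of implications.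
  mutual
    ≅⇒⊢ : ∀ {n} {Γ : List (Form S n)} {A} (B : Form S n) → A ≅ B → (A ∷ Γ) ⊢ B
    ≅⇒⊢ (atomF β) (atom≅ refl) = hyp (here refl)
    ≅⇒⊢ ⊤F        ⊤≅           = ⊤I
    ≅⇒⊢ ⊥F        ⊥≅           = hyp (here refl)
    ≅⇒⊢ (B ∧F C)  (p ∧≅ q)     =
      ∧I (cut (∧E₁ (hyp (here refl))) (≅⇒⊢ B p)) (cut (∧E₂ (hyp (here refl))) (≅⇒⊢ C q))
    ≅⇒⊢ (⋁F I ψ)  (⋁≅ p)       = ⋁E (hyp (here refl)) (λ i → ⋁I i (≅⇒⊢ (ψ i) (p i)))
    ≅⇒⊢ (B ⇒F C)  (p ⇒≅ q)     =
      ⇒I (cut (⇒E (hyp (there (here refl))) (≅⇐⊢ B p)) (≅⇒⊢ C q))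
    ≅⇒⊢ (∀F B)    (∀≅ {A = A} p) =
      ∀I (cut (∀E (hyp (here refl)) (var zero)) (≅⇒⊢ B (≅-trans (F-unshift A) p)))
    ≅⇒⊢ (∃F B)    (∃≅ p)       =
      ∃E (hyp (here refl)) (∃I (var zero) (cut (≅⇒⊢ B p) (≅⇐⊢ B (F-unshift B))))

    ≅⇐⊢ : ∀ {n} {Γ : List (Form S n)} {A} (B : Form S n) → A ≅ B → (B ∷ Γ) ⊢ A
    ≅⇐⊢ (atomF β) (atom≅ refl) = hyp (here refl)
    ≅⇐⊢ ⊤F        ⊤≅           = ⊤I
    ≅⇐⊢ ⊥F        ⊥≅           = hyp (here refl)
    ≅⇐⊢ (B ∧F C)  (p ∧≅ q)     =
      ∧I (cut (∧E₁ (hyp (here refl))) (≅⇐⊢ B p)) (cut (∧E₂ (hyp (here refl))) (≅⇐⊢ C q))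
    ≅⇐⊢ (⋁F I ψ)  (⋁≅ p)       = ⋁E (hyp (here refl)) (λ i → ⋁I i (≅⇐⊢ (ψ i) (p i)))
    ≅⇐⊢ (B ⇒F C)  (p ⇒≅ q)     =
      ⇒I (cut (⇒E (hyp (there (here refl))) (≅⇒⊢ B p)) (≅⇐⊢ C q))
    ≅⇐⊢ (∀F B)    (∀≅ p)       =
      ∀I (cut (cut (∀E (hyp (here refl)) (var zero)) (≅⇒⊢ B (F-unshift B))) (≅⇐⊢ B p))
    ≅⇐⊢ (∃F B)    (∃≅ {A = A} p) =
      ∃E (hyp (here refl)) (∃I (var zero) (≅⇐⊢ B (≅-trans (F-unshift A) p)))

  cast : ∀ {n} {Γ : List (Form S n)} {A B} → A ≅ B → Γ ⊢ A → Γ ⊢ B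
  cast {B = B} p d = cut d (≅⇒⊢ B p)

  _⊆[_]_ : ∀ {n m} → List (Form S n) → Subst S n m → List (Form S m) → Set₁
  _⊆[_]_ {m = m} Γ σ Δ = ∀ {B} → B ∈ Γ → Σ (Form S m) λ B′ → B′ ∈ Δ × (B ⟦ σ ⟧F ≅ B′)

  ⊆-∷ : ∀ {n m} {Γ : List (Form S n)} {Δ} {σ : Subst S n m} {A} →
    Γ ⊆[ σ ] Δ → (A ∷ Γ) ⊆[ σ ] (A ⟦ σ ⟧F ∷ Δ)
  ⊆-∷ {A = A} H (here refl) = A ⟦ _ ⟧F , here refl , ≅-refl _
  ⊆-∷ H (there p) with H p
  ... | B′ , m , e = B′ , there m , e

  ⊆-wk : ∀ {n m} {Γ : List (Form S n)} {Δ} {σ : Subst S n m} →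
    Γ ⊆[ σ ] Δ → map (wkF S) Γ ⊆[ ⇧ σ ] map (wkF S) Δ
  ⊆-wk {σ = σ} H p with ∈-map⁻ (wkF S) p
  ... | B , m , refl with H m
  ... | B′ , m′ , e = wkF S B′ , ∈-map⁺ (wkF S) m′ , ≅-trans (F-wk B σ) (F-cong wk1 e)

  ⊢-subst : ∀ {n m} {Γ : List (Form S n)} {Δ} {σ : Subst S n m} {A} →
    Γ ⊆[ σ ] Δ → Γ ⊢ A → Δ ⊢ A ⟦ σ ⟧F
  ⊢-subst H (hyp p) with H p
  ... | B′ , m , e = cast (≅-sym e) (hyp m)
  ⊢-subst H (ax a)      = cast (≅-sym (F-fuse (λ ()) (axForm S (axiom T a)))) (ax a)
  ⊢-subst H ⊤I          = ⊤I
  ⊢-subst H (⊥E d)      = ⊥E (⊢-subst H d)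
  ⊢-subst H (∧I d e)    = ∧I (⊢-subst H d) (⊢-subst H e)
  ⊢-subst H (∧E₁ d)     = ∧E₁ (⊢-subst H d)
  ⊢-subst H (∧E₂ d)     = ∧E₂ (⊢-subst H d)
  ⊢-subst H (⋁I i d)    = ⋁I i (⊢-subst H d)
  ⊢-subst H (⋁E d e)    = ⋁E (⊢-subst H d) (λ i → ⊢-subst (⊆-∷ H) (e i))
  ⊢-subst H (⇒I d)      = ⇒I (⊢-subst (⊆-∷ H) d)
  ⊢-subst H (⇒E d e)    = ⇒E (⊢-subst H d) (⊢-subst H e)
  ⊢-subst H (∀I d)      = ∀I (⊢-subst (⊆-wk H) d)
  ⊢-subst {σ = σ} H (∀E {φ} d t) = cast (F-inst φ σ t) (∀E (⊢-subst H d) (t ⟦ σ ⟧))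
  ⊢-subst {σ = σ} H (∃I {φ} t d) = ∃I (t ⟦ σ ⟧) (cast (≅-sym (F-inst φ σ t)) (⊢-subst H d))
  ⊢-subst {σ = σ} H (∃E {ψ = ψ} d e) =
    ∃E (⊢-subst H d) (cast (F-wk ψ σ) (⊢-subst (⊆-∷ (⊆-wk H)) e))

  weaken : ∀ {n} {Γ Δ : List (Form S n)} {A} → (∀ {B} → B ∈ Γ → B ∈ Δ) → Γ ⊢ A → Δ ⊢ A
  weaken {A = A} inc d = cast (F-id A) (⊢-subst (λ p → _ , inc p , F-id _) d)

  discharge : ∀ {n} (L : List (Form S n)) {Θ A} → (∀ {B} → B ∈ L → Θ ⊢ B) → L ⊢ A → Θ ⊢ A
  discharge []      H d = weaken (λ ()) d
  discharge (B ∷ L) H d = ⇒E (discharge L (H ∘ there) (⇒I d)) (H (here refl))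

  conj-intro : ∀ {n m} {Θ : List (Form S m)} (l : List (Atom S n)) (τ : Subst S n m) →
    (∀ α → α ∈ l → Θ ⊢ atomF (α ⟦ τ ⟧ₐ)) → Θ ⊢ conjF S l ⟦ τ ⟧F
  conj-intro []      τ H = ⊤I
  conj-intro (α ∷ l) τ H = ∧I (H α (here refl)) (conj-intro l τ (λ β p → H β (there p)))

  conj-proj : ∀ {n m} {Θ : List (Form S m)} (l : List (Atom S n)) (τ : Subst S n m) {β} →
    Θ ⊢ conjF S l ⟦ τ ⟧F → β ∈ l → Θ ⊢ atomF (β ⟦ τ ⟧ₐ)
  conj-proj (α ∷ l) τ d (here refl) = ∧E₁ d
  conj-proj (α ∷ l) τ d (there p)   = conj-proj l τ (∧E₂ d) p

  inst-closure : ∀ u {m} (φ : Form S u) {Γ : List (Form S m)} →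
    Γ ⊢ closedWk S (∀c S u φ) → (τ : Subst S u m) → Γ ⊢ φ ⟦ τ ⟧F
  inst-closure zero    φ d τ = cast (F-ext (λ ()) φ) d
  inst-closure (suc u) φ d τ =
    cast (F-fuse (λ { zero → refl ; (suc x) → ⇧-inst (τ ∘ suc) (τ zero) (suc x) }) φ)
         (∀E (inst-closure u (∀F φ) d (τ ∘ suc)) (τ zero))

  wkS : ∀ k {m} → Subst S m (k + m)
  wkS k = wkSub S k

  instS : ∀ k {u m} → Subst S u m → Subst S (k + u) (k + m)
  instS k σ = instSub S k σ

  wkS-suc : ∀ k {m} (A : Form S m) → A ⟦ wkS k ⟧F ⟦ wk1 ⟧F ≅ A ⟦ wkS (suc k) ⟧F
  wkS-suc k A = F-fuse (λ _ → refl) A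

  ⇧-instS : ∀ k {u m} (σ : Subst S u m) → ⇧ (instS k σ) ≈ instS (suc k) σ
  ⇧-instS k σ zero = refl
  ⇧-instS k σ (suc y) with splitAt k y
  ... | inj₁ j = refl
  ... | inj₂ z = tm-comp (wkS k) wk1 (σ z)

  -- Existential elimination for a block of k quantifiers: the witnesses
  -- become the first k variables of the extended context.
  ∃*-elim : ∀ k {u m} (φ : Form S (k + u)) (σ : Subst S u m) {Γ : List (Form S m)} {Y} →
    Γ ⊢ ∃* S k φ ⟦ σ ⟧F →
    (φ ⟦ instS k σ ⟧F ∷ map (_⟦ wkS k ⟧F) Γ) ⊢ Y ⟦ wkS k ⟧F → Γ ⊢ Y
  ∃*-elim zero φ σ {Γ} {Y} d e = cut d (cast (≅-trans (F-id _) (F-id Y)) (⊢-subst H e))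
    where
      H : (φ ⟦ instS 0 σ ⟧F ∷ map (_⟦ wkS 0 ⟧F) Γ) ⊆[ var ] (φ ⟦ σ ⟧F ∷ Γ)
      H (here refl) = _ , here refl , F-fuse (λ x → trans (tm-id _) (tm-id (σ x))) φ
      H (there p) with ∈-map⁻ (_⟦ wkS 0 ⟧F) p
      ... | B , m , refl = B , there m , ≅-trans (F-id _) (F-id B)
  ∃*-elim (suc k) φ σ {Γ} {Y} d e =
    ∃*-elim k (∃F φ) σ d
      (∃E (hyp (here refl)) (cast (≅-trans (F-id _) (≅-sym (wkS-suc k Y))) (⊢-subst H e)))
    where
      H : (φ ⟦ instS (suc k) σ ⟧F ∷ map (_⟦ wkS (suc k) ⟧F) Γ)
            ⊆[ var ] (φ ⟦ ⇧ (instS k σ) ⟧F ∷ map (wkF S) (∃F φ ⟦ instS k σ ⟧F ∷ map (_⟦ wkS k ⟧F) Γ))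
      H (here refl) = _ , here refl ,
        F-fuse (λ x → trans (tm-id _) (sym (⇧-instS k σ x))) φ
      H (there p) with ∈-map⁻ (_⟦ wkS (suc k) ⟧F) p
      ... | B , m , refl = _ , there (there (∈-map⁺ (wkF S) (∈-map⁺ (_⟦ wkS k ⟧F) m))) ,
        ≅-trans (F-id _) (≅-sym (wkS-suc k B))

module Admissibility (S : Signature) where
  open Substitution S

  var-injective : ∀ {n} {x y : Fin n} → var {S = S} x ≡ var y → x ≡ y
  var-injective refl = refl

  adm-id : ∀ κ {n} → Adm S κ (var {S = S} {n = n})
  adm-id ts = tt
  adm-id vs = λ x → x , refl
  adm-id rn = (λ x → x , refl) , (λ x y → var-injective)

  adm-wk1 : ∀ κ {n} → Adm S κ (wk1 {n})
  adm-wk1 ts = tt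
  adm-wk1 vs = λ x → suc x , refl
  adm-wk1 rn = (λ x → suc x , refl) , (λ x y → suc-injective ∘ var-injective)

  adm-restrict : ∀ κ {n m} k (τ : Subst S (k + n) m) → Adm S κ τ → Adm S κ (λ x → τ (k ↑ʳ x))
  adm-restrict ts k τ A       = tt
  adm-restrict vs k τ A       = λ x → A (k ↑ʳ x)
  adm-restrict rn k τ (A , I) = (λ x → A (k ↑ʳ x)) , (λ x y e → ↑ʳ-injective k x y (I _ _ e))

module Soundness (S : Signature) (T : Theory S) (κ : Kind) where
  open Substitution S
  open Derivations S T
  open Deduction S T
  open Covers S κ T
  open Forcing S κ T
  open Admissibility S

  hyps : (C : Cond S) → List (Form S (nv C))
  hyps C = map atomF (atoms C)

  hyps-⊆ : ∀ {D C} (f : Hom S κ D C) → hyps C ⊆[ sub f ] hyps D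
  hyps-⊆ f p with ∈-map⁻ atomF p
  ... | b , m , refl = atomF (b ⟦ sub f ⟧ₐ) , ∈-map⁺ atomF (pres f m) , ≅-refl _

  idHom : (C : Cond S) → Hom S κ C C
  idHom C = record { sub = var ; pres = λ {α} → subst (_∈ atoms C) (sym (at-id α)) ; adm = adm-id κ }

  withAtom : (C : Cond S) → Atom S (nv C) → Cond S
  withAtom C b = cond (nv C) (b ∷ atoms C)

  withAtomHom : (C : Cond S) (b : Atom S (nv C)) → Hom S κ (withAtom C b) C
  withAtomHom C b = record
    { sub = var ; pres = λ {α} → there ∘ subst (_∈ atoms C) (sym (at-id α)) ; adm = adm-id κ }

  fresh : Cond S → Cond S
  fresh C = cond (suc (nv C)) (map (_⟦ wk1 ⟧ₐ) (atoms C))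

  freshHom : (C : Cond S) → Hom S κ (fresh C) C
  freshHom C = record { sub = wk1 ; pres = ∈-map⁺ (_⟦ wk1 ⟧ₐ) ; adm = adm-wk1 κ }

  fresh-hyps : (C : Cond S) → hyps (fresh C) ≡ map (wkF S) (hyps C)
  fresh-hyps C = trans (sym (map-∘ (atoms C))) (map-∘ (atoms C))

  viaExtension : ∀ {C D} (a : Axiom S) (σ : Subst S (univ a) (nv C)) (i : Fin (ndisj a)) →
    Hom S κ D (extCond S C a σ i) → Hom S κ D C
  viaExtension {C} {D} a σ i h = record
    { sub  = λ x → sub h (k ↑ʳ x)
    ; pres = λ {α} m → subst (_∈ atoms D) (at-comp (wkS k) (sub h) α)
                             (pres h (∈-++⁺ˡ (∈-map⁺ (_⟦ wkS k ⟧ₐ) m)))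
    ; adm  = adm-restrict κ k (sub h) (adm h) }
    where k = exv a i

  atom-forced : ∀ {C n} (α : Atom S n) (ρ : Subst S n (nv C)) → α ⟦ ρ ⟧ₐ ∈ atoms C →
    ForceB C (atomB α) ρ
  atom-forced {C} α ρ m =
    isoCov (idHom C) (idHom C , (λ _ → refl) , (λ _ → refl)) ,
    λ { f (memIso f≈id) → subst (_∈ atoms _) (sym (trans (at-comp ρ (sub f) α) (at-ext (⨟-var f≈id) α))) m }

  -- In the branch for disjunct i of an axiom instance, every atom of the
  -- corresponding extension of C is derivable: the old atoms (weakened)
  -- are hypotheses, the new ones are conjuncts of the instantiated conclusion.
  extension-atoms : ∀ {C} (a : Axiom S) (σ : Subst S (univ a) (nv C)) (i : Fin (ndisj a))
    (Y : Form S (nv C)) {B} → B ∈ hyps (extCond S C a σ i) →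
    (conjF S (concl a i) ⟦ instS (exv a i) σ ⟧F ∷ map (_⟦ wkS (exv a i) ⟧F) (Y ∷ hyps C)) ⊢ B
  extension-atoms {C} a σ i Y p with ∈-map⁻ atomF p
  ... | b , m , refl with ∈-++⁻ (map (_⟦ wkS (exv a i) ⟧ₐ) (atoms C)) m
  ... | inj₁ old with ∈-map⁻ (_⟦ wkS (exv a i) ⟧ₐ) old
  ...   | b₀ , m₀ , refl = hyp (there (there (∈-map⁺ (_⟦ wkS (exv a i) ⟧F) (∈-map⁺ atomF m₀))))
  extension-atoms a σ i Y p | b , m , refl | inj₂ new with ∈-map⁻ (_⟦ instS (exv a i) σ ⟧ₐ) new
  ...   | β , mβ , refl = conj-proj (concl a i) (instS (exv a i) σ) (hyp (here refl)) mβ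

  -- An isomorphism member is inverted;
  -- an axiom step is mirrored by applying that axiom and eliminating its
  -- disjunction and existentials.
  local : ∀ {k C} (U : Cover C) (X : Form S k) (ρ : Subst S k (nv C)) →
    (∀ {D} (f : Hom S κ D C) → Mem U f → hyps D ⊢ X ⟦ ρ ⨟ sub f ⟧F) → hyps C ⊢ X ⟦ ρ ⟧F
  local (isoCov g (h , g⨟h≈id , _)) X ρ onMembers =
    cast (F-fuse (λ x → trans (⨟-assoc ρ (sub g) (sub h) x) (⨟-var {σ = ρ} g⨟h≈id x)) X)
         (⊢-subst (hyps-⊆ h) (onMembers g (memIso (λ _ → refl))))
  local {C = C} (axCov axm σ premises U) X ρ onMembers =
    ⋁E (⇒E (inst-closure (univ a) _ (ax axm) σ)
           (conj-intro (prem a) σ (λ α m → hyp (∈-map⁺ atomF (premises α m)))))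
       (λ i → ∃*-elim (exv a i) (conjF S (concl a i)) σ (hyp (here refl)) (branch i))
    where
      a = axiom T axm

      branch : ∀ i → (conjF S (concl a i) ⟦ instS (exv a i) σ ⟧F ∷
                      map (_⟦ wkS (exv a i) ⟧F) (∃* S (exv a i) (conjF S (concl a i)) ⟦ σ ⟧F ∷ hyps C))
                     ⊢ X ⟦ ρ ⟧F ⟦ wkS (exv a i) ⟧F
      branch i = cast (≅-sym (F-comp X))
        (discharge (hyps (extCond S C a σ i)) (extension-atoms {C} a σ i _)
          (local (U i) X (ρ ⨟ wkS (exv a i)) λ h m →
            cast (F-ext (λ x → sym (⨟-assoc ρ (wkS (exv a i)) (sub h) x)) X)
                 (onMembers (viaExtension a σ i h) (memAx i m (λ _ → refl)))))

  soundness : ∀ {n} (φ : GG S n) (C : Cond S) (ρ : Subst S n (nv C)) →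
    Force C φ ρ → hyps C ⊢ embGG S φ ⟦ ρ ⟧F
  soundness (base (atomB α)) C ρ (U , onMembers) =
    local U (atomF α) ρ λ {D} f m →
      hyp (∈-map⁺ atomF (subst (_∈ atoms D) (at-comp ρ (sub f) α) (onMembers f m)))
  soundness (base ⊤B) C ρ _ = ⊤I
  soundness (base ⊥B) C ρ (U , onMembers) = local U ⊥F ρ (λ f m → ⊥-elim (onMembers f m))
  soundness (φ ∧G ψ) C ρ (φ-forced , ψ-forced) = ∧I (soundness φ C ρ φ-forced) (soundness ψ C ρ ψ-forced)
  soundness (⋁G I φ) C ρ (U , onMembers) =
    local U (embGG S (⋁G I φ)) ρ λ {D} f m →
      let (i , forced) = onMembers f m in ⋁I i (soundness (φ i) D (ρ ⨟ sub f) forced)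
  soundness (∃G φ) C ρ (U , onMembers) =
    local U (embGG S (∃G φ)) ρ λ {D} f m →
      let (t , forced) = onMembers f m in
      ∃I t (cast (≅-sym (F-fuse (⇧-inst (ρ ⨟ sub f) t) (embGG S φ))) (soundness φ D _ forced))
  soundness (∀G φ) C ρ forced =
    ∀I (subst (_⊢ embGG S φ ⟦ ⇧ ρ ⟧F) (fresh-hyps C)
      (cast (F-ext (λ { zero → refl ; (suc x) → refl }) (embGG S φ))
            (soundness φ (fresh C) _ (forced (fresh C) (freshHom C) (var zero)))))
  soundness (atomB α ⇒G φ) C ρ forced =
    ⇒I (cast (F-ext ⨟-idʳ (embGG S φ))
             (soundness φ D (ρ ⨟ var) (forced D (withAtomHom C (α ⟦ ρ ⟧ₐ)) α-forced)))
    where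
      D = withAtom C (α ⟦ ρ ⟧ₐ)
      α-forced : ForceB D (atomB α) (ρ ⨟ var)
      α-forced = atom-forced α (ρ ⨟ var) (here (at-ext ⨟-idʳ α))
  soundness (⊤B ⇒G φ) C ρ forced =
    ⇒I (weaken there (cast (F-ext ⨟-idʳ (embGG S φ))
                           (soundness φ C (ρ ⨟ var) (forced C (idHom C) tt))))
  soundness (⊥B ⇒G φ) C ρ _ = ⇒I (⊥E (hyp (here refl)))

corollary5p9 : (S : Signature) (κ : Kind) (T : Theory S) (φ : GG S 0)
    → Forcing._⊩_ S κ T (empty S) φ
    → Deduction.⊢∅ S T (embGG S φ)
corollary5p9 S κ T φ forced = cast (F-id (embGG S φ)) (soundness φ (empty S) var forced)
  where
    open Substitution S
    open Derivations S T
    open Soundness S T κ
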